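{- For every $n\geq 8$, resolving sets do not have the exchange property in the $n$-wheel $W_n$: there exist minimal resolving sets $S,R$ of $W_n$ and $r\in R$ such that for every $s\in S$ the set $(S\setminus\{s\})\cup\{r\}$ is not a minimal resolving set of $W_n$.
   Context: The $n$-wheel $W_n$ is the join of the cycle $C_n$ with $K_1$: an $n$-cycle together with one additional vertex adjacent to every vertex of the cycle. For a connected graph $G$ with shortest-path distance $d$, $W\subseteq V(G)$ is a resolving set if for every two distinct vertices $u,v$ there is $w\in W$ with $d(w,u)\neq d(w,v)$; it is minimal if no proper subset is a resolving set. Resolving sets have the exchange property in $G$ if whenever $S,R$ are minimal resolving sets and $r\in R$, there is $s\in S$ with $(S\setminus\{s\})\cup\{r\}$ a minimal resolving set. -}

module Defs where

open import Data.Nat using (ℕ; zero; suc; _≤_)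
open import Data.Fin using (Fin; zero; suc; toℕ)
open import Data.Fin.Subset using (Subset; _∈_; _⊂_)
open import Data.Product using (Σ; ∃; _×_)
open import Data.Sum using (_⊎_)
open import Relation.Nullary using (¬_)
open import Relation.Binary.PropositionalEquality using (_≡_; _≢_)

Graph : ℕ → Set₁
Graph m = Fin m → Fin m → Set

data Walk {m : ℕ} (G : Graph m) : Fin m → Fin m → ℕ → Set where
  here : ∀ {u} → Walk G u u zero
  step : ∀ {u w v k} → G u w → Walk G w v k → Walk G u v (suc k)

Dist : {m : ℕ} → Graph m → Fin m → Fin m → ℕ → Set
Dist G u v k = Walk G u v k × (∀ l → Walk G u v l → k ≤ l)

Resolving : {m : ℕ} → Graph m → Subset m → Set
Resolving {m} G W =
  (u v : Fin m) → u ≢ v →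
  Σ (Fin m) λ w → w ∈ W × Σ ℕ λ k → Σ ℕ λ l → Dist G w u k × Dist G w v l × k ≢ l

MinimalResolving : {m : ℕ} → Graph m → Subset m → Set
MinimalResolving {m} G W = Resolving G W × (∀ (T : Subset m) → T ⊂ W → ¬ Resolving G T)

-- The n-wheel W_n on vertex set Fin (suc n): vertex zero is the hub,
-- vertex suc i (i : Fin n) is the i-th cycle vertex; cycle vertex i is
-- adjacent to cycle vertex (i + 1) mod n (and symmetrically).
-- j is the successor of i on the n-cycle 0 → 1 → … → n-1 → 0.
CycleNext : (n : ℕ) → Fin n → Fin n → Set
CycleNext n i j = (suc (toℕ i) ≡ toℕ j) ⊎ (suc (toℕ i) ≡ n × toℕ j ≡ 0)

data WheelAdj (n : ℕ) : Fin (suc n) → Fin (suc n) → Set where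
  hub-rim : ∀ (i : Fin n) → WheelAdj n zero (suc i)
  rim-hub : ∀ (i : Fin n) → WheelAdj n (suc i) zero
  rim-next : ∀ (i j : Fin n) → CycleNext n i j → WheelAdj n (suc i) (suc j)
  rim-prev : ∀ (i j : Fin n) → CycleNext n j i → WheelAdj n (suc i) (suc j)

Wheel : (n : ℕ) → Graph (suc n)
Wheel n = WheelAdj n

-- In W_n every distance is 0, 1 or 2. Call a rim vertex a hole of a set T of rim vertices if
-- neither it nor its two neighbours lie in T; every member of T is at distance 2 from every hole,
-- so two holes are never separated. Conversely T resolves W_n as soon as it has at most one hole,
-- every member with no neighbour in T has a member two steps away along the rim, and the hub is
-- separated from every non-member. If such a T is independent with exactly one hole, it is a
-- minimal resolving set: deleting a member s makes s a second hole. If moreover the rim reads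
-- 0 0 1 r 1 0 0 around some r ∉ T, then exchanging any member of T for r still leaves two holes,
-- whereas r lies in the rotation of T, another minimal resolving set. Such T exist for odd n ≥ 11
-- and even n ≥ 16: the rim words 10100010100(10)ʲ and 1010001010010100(10)ʲ. The wheels with
-- n ∈ {8, 9, 10, 12, 14} are settled by exhaustive computation.
module Submission where

open import Data.Bool using (Bool; true; false; not)
open import Data.Bool.ListAction using (any)
open import Data.Bool.Properties using () renaming (_≟_ to _≟ᵇ_)
open import Data.Empty using (⊥; ⊥-elim)
open import Data.Fin using (Fin; zero; suc; toℕ; fromℕ<; #_)
open import Data.Fin.Properties using (toℕ-injective; toℕ<n; toℕ-fromℕ<; suc-injective; all?; any?)
  renaming (_≟_ to _≟ᶠ_)
open import Data.Fin.Subset using (Subset; _∈_; _∉_; _⊆_; _-_; _∪_; ⁅_⁆; outside)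
open import Data.Fin.Subset.Properties
  using (_∈?_; x∈p⇒p-x⊂p; x∈p∧x≢y⇒x∈p-y; p─q⊆p; x∈p∪q⁻; x∈⁅y⁆⇒x≡y)
open import Data.List using (List; []; _∷_; length)
open import Data.Nat using (ℕ; zero; suc; _+_; _*_; _∸_; _≤_; _<_; z≤n; s≤s; _<?_; _≡ᵇ_)
open import Data.Nat.GeneralisedArithmetic using (iterate)
open import Data.Nat.Properties
  using (_≟_; ≤-refl; ≤-trans; ≤-antisym; ≤-reflexive; ≤-pred; n≤1+n; <-irrefl; <⇒≢; <⇒≱; ≮⇒≥;
         ≤-<-trans; <-≤-trans; m≤n⇒m<n∨m≡n; m≤n⇒∃[o]m+o≡n; m≤m+n; m≤n+m; +-suc; +-comm;
         +-assoc; +-identityʳ; +-cancelˡ-≡; +-cancelʳ-<; +-monoʳ-<; *-suc; *-distribˡ-+)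
open import Data.Product using (Σ; _×_; _,_; proj₁; proj₂)
open import Data.Sum using (_⊎_; inj₁; inj₂; map₂)
open import Data.Vec using (_∷_; tabulate; there)
open import Data.Vec.Functional using (updateAt)
open import Data.Vec.Functional.Properties using (updateAt-updates; updateAt-minimal)
open import Data.Vec.Properties using (lookup∘tabulate; lookup⇒[]=; []=⇒lookup)
open import Function.Base using (_∘_; case_of_)
open import Relation.Nullary using (¬_; Dec; yes; no)
open import Relation.Nullary.Decidable using (map′; ¬?; _×-dec_; _⊎-dec_; _→-dec_; toWitness; True)
open import Relation.Binary.PropositionalEquality
  using (_≡_; _≢_; refl; sym; trans; cong; subst; module ≡-Reasoning)

open import Defs

-- Resolving sets in an arbitrary graph

module _ {m : ℕ} {G : Graph m} where

  resolving-⊆ : ∀ {T U} → T ⊆ U → Resolving G T → Resolving G U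
  resolving-⊆ T⊆U res u v u≢v with res u v u≢v
  ... | w , w∈T , separation = w , T⊆U w∈T , separation

  minimalResolving⁺ : ∀ {W} → Resolving G W → (∀ x → x ∈ W → ¬ Resolving G (W - x)) →
                      MinimalResolving G W
  minimalResolving⁺ res critical = res , λ where
    T (T⊆W , x , x∈W , x∉T) resT →
      critical x x∈W (resolving-⊆ (λ y∈T → x∈p∧x≢y⇒x∈p-y (T⊆W y∈T) λ { refl → x∉T y∈T }) resT)

  minimalResolving⁻ : ∀ {W} → MinimalResolving G W → ∀ x → x ∈ W → ¬ Resolving G (W - x)
  minimalResolving⁻ (_ , minimal) x x∈W = minimal _ (x∈p⇒p-x⊂p x∈W)

  minimalResolving? : (∀ W → Dec (Resolving G W)) → ∀ W → Dec (MinimalResolving G W)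
  minimalResolving? resolving? W =
    map′ (λ (res , critical) → minimalResolving⁺ res critical)
         (λ min → proj₁ min , minimalResolving⁻ min)
         (resolving? W ×-dec all? λ x → x ∈? W →-dec ¬? (resolving? (W - x)))

x∉p-x : ∀ {m} {x : Fin m} {p : Subset m} → x ∉ p - x
x∉p-x {x = zero} {_ ∷ _} ()
x∉p-x {x = suc x} {_ ∷ p} (there x∈) = x∉p-x {x = x} {p} x∈

x∈p-y⁻ : ∀ {m} {x y : Fin m} {p : Subset m} → x ∈ p - y → x ∈ p × x ≢ y
x∈p-y⁻ {p = p} x∈ = p─q⊆p p _ x∈ , λ { refl → x∉p-x {p = p} x∈ }

-- The rim cycle

module Rim (n : ℕ) where

  next : ℕ → ℕ
  next m with suc m ≟ n
  ... | yes _ = 0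
  ... | no _ = suc m

  prev : ℕ → ℕ
  prev zero = n ∸ 1
  prev (suc m) = m

  next-last : ∀ {m} → suc m ≡ n → next m ≡ 0
  next-last {m} m+1≡n with suc m ≟ n
  ... | yes _ = refl
  ... | no m+1≢n = ⊥-elim (m+1≢n m+1≡n)

  next-inner : ∀ {m} → suc m < n → next m ≡ suc m
  next-inner {m} m+1<n with suc m ≟ n
  ... | yes m+1≡n = ⊥-elim (<-irrefl m+1≡n m+1<n)
  ... | no _ = refl

  next< : ∀ {m} → m < n → next m < n
  next< {m} m<n with m≤n⇒m<n∨m≡n m<n
  ... | inj₁ m+1<n = subst (_< n) (sym (next-inner m+1<n)) m+1<n
  ... | inj₂ m+1≡n = subst (_< n) (sym (next-last m+1≡n)) (≤-trans (s≤s z≤n) m<n)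

  prev< : ∀ {m} → m < n → prev m < n
  prev< {zero} (s≤s z≤n) = ≤-refl
  prev< {suc m} m<n = ≤-trans (n≤1+n (suc m)) m<n

  next-prev : ∀ {m} → m < n → next (prev m) ≡ m
  next-prev {zero} (s≤s z≤n) = next-last refl
  next-prev {suc m} m<n = next-inner m<n

  prev-next : ∀ {m} → m < n → prev (next m) ≡ m
  prev-next {m} m<n with m≤n⇒m<n∨m≡n m<n
  ... | inj₁ m+1<n = cong prev (next-inner m+1<n)
  ... | inj₂ m+1≡n = trans (cong prev (next-last m+1≡n)) (cong (_∸ 1) (sym m+1≡n))

  -- Opaque, because letting the conversion checker unfold nx is prohibitively slow.
  opaque
    nx pv : Fin n → Fin n
    nx i = fromℕ< (next< (toℕ<n i))
    pv i = fromℕ< (prev< (toℕ<n i))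

    toℕ-nx : ∀ i → toℕ (nx i) ≡ next (toℕ i)
    toℕ-nx i = toℕ-fromℕ< _

    toℕ-pv : ∀ i → toℕ (pv i) ≡ prev (toℕ i)
    toℕ-pv i = toℕ-fromℕ< _

  nx-pv : ∀ i → nx (pv i) ≡ i
  nx-pv i = toℕ-injective (trans (toℕ-nx (pv i)) (trans (cong next (toℕ-pv i)) (next-prev (toℕ<n i))))

  pv-nx : ∀ i → pv (nx i) ≡ i
  pv-nx i = toℕ-injective (trans (toℕ-pv (nx i)) (trans (cong prev (toℕ-nx i)) (prev-next (toℕ<n i))))

  cycleNext-nx : ∀ i → CycleNext n i (nx i)
  cycleNext-nx i with m≤n⇒m<n∨m≡n (toℕ<n i)
  ... | inj₁ i+1<n = inj₁ (sym (trans (toℕ-nx i) (next-inner i+1<n)))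
  ... | inj₂ i+1≡n = inj₂ (i+1≡n , trans (toℕ-nx i) (next-last i+1≡n))

  cycleNext⇒nx : ∀ {i j} → CycleNext n i j → j ≡ nx i
  cycleNext⇒nx {i} {j} c = toℕ-injective (trans (position c) (sym (toℕ-nx i)))
    where
    position : CycleNext n i j → toℕ j ≡ next (toℕ i)
    position (inj₁ i+1≡j) = sym (trans (next-inner (subst (_< n) (sym i+1≡j) (toℕ<n j))) i+1≡j)
    position (inj₂ (i+1≡n , j≡0)) = trans j≡0 (sym (next-last i+1≡n))

  private
    shift : ∀ m k {a} → suc m ≡ a → a + k ≡ m + suc k
    shift m k refl = sym (+-suc m k)

  nx^-position : ∀ k x → k < n →
    toℕ (iterate nx x k) ≡ toℕ x + k ⊎ toℕ (iterate nx x k) + n ≡ toℕ x + k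
  nx^-position zero x _ = inj₁ (sym (+-identityʳ (toℕ x)))
  nx^-position (suc k) x k+1<n with cycleNext-nx x | nx^-position k (nx x) k<n
    where k<n = ≤-trans (n≤1+n _) k+1<n
  ... | inj₁ x+1≡nx | inj₁ p = inj₁ (trans p (shift (toℕ x) k x+1≡nx))
  ... | inj₁ x+1≡nx | inj₂ p = inj₂ (trans p (shift (toℕ x) k x+1≡nx))
  ... | inj₂ (x+1≡n , nx≡0) | inj₁ p = inj₂ (begin
    toℕ (iterate nx (nx x) k) + n  ≡⟨ cong (_+ n) (trans p (cong (_+ k) nx≡0)) ⟩
    k + n                          ≡⟨ +-comm k n ⟩
    n + k                          ≡⟨ shift (toℕ x) k x+1≡n ⟩
    toℕ x + suc k                  ∎)
    where open ≡-Reasoning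
  ... | inj₂ (_ , nx≡0) | inj₂ p =
    ⊥-elim (<⇒≱ (≤-trans (n≤1+n _) k+1<n) (≤-trans (m≤n+m n _) (≤-reflexive (trans p (cong (_+ k) nx≡0)))))

  nx^-inner : ∀ k x → toℕ x + k < n → toℕ (iterate nx x k) ≡ toℕ x + k
  nx^-inner k x x+k<n with nx^-position k x (≤-<-trans (m≤n+m k (toℕ x)) x+k<n)
  ... | inj₁ p = p
  ... | inj₂ p = ⊥-elim (<⇒≱ x+k<n (≤-trans (m≤n+m n _) (≤-reflexive p)))

  nx^-irrefl : ∀ k x → 0 < k → k < n → iterate nx x k ≢ x
  nx^-irrefl k x 0<k k<n e with nx^-position k x k<n
  ... | inj₁ p = <⇒≢ 0<k (sym (+-cancelˡ-≡ (toℕ x) k 0 (trans (sym p) (trans (cong toℕ e) (sym (+-identityʳ _))))))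
  ... | inj₂ p = <⇒≢ k<n (sym (+-cancelˡ-≡ (toℕ x) n k (trans (cong (λ y → toℕ y + n) (sym e)) p)))

-- Distances in the wheel

module Distance (n : ℕ) where
  open Rim n

  Adj : Fin n → Fin n → Set
  Adj i j = j ≡ nx i ⊎ j ≡ pv i

  adj? : ∀ i j → Dec (Adj i j)
  adj? i j = (j ≟ᶠ nx i) ⊎-dec (j ≟ᶠ pv i)

  adj-sym : ∀ {i j} → Adj i j → Adj j i
  adj-sym {i} (inj₁ refl) = inj₂ (sym (pv-nx i))
  adj-sym {i} (inj₂ refl) = inj₁ (sym (nx-pv i))

  wheelAdj⇒adj : ∀ {i j} → WheelAdj n (suc i) (suc j) → Adj i j
  wheelAdj⇒adj (rim-next i j c) = inj₁ (cycleNext⇒nx c)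
  wheelAdj⇒adj (rim-prev i j c) = adj-sym (inj₁ (cycleNext⇒nx c))

  adj⇒wheelAdj : ∀ {i j} → Adj i j → WheelAdj n (suc i) (suc j)
  adj⇒wheelAdj {i} (inj₁ refl) = rim-next i (nx i) (cycleNext-nx i)
  adj⇒wheelAdj {i} (inj₂ refl) = rim-prev i (pv i) (subst (CycleNext n (pv i)) (nx-pv i) (cycleNext-nx (pv i)))

  rimDistance : ∀ {i j : Fin n} → Dec (i ≡ j) → Dec (Adj i j) → ℕ
  rimDistance (yes _) _ = 0
  rimDistance (no _) (yes _) = 1
  rimDistance (no _) (no _) = 2

  d : Fin (suc n) → Fin (suc n) → ℕ
  d zero zero = 0
  d zero (suc _) = 1
  d (suc _) zero = 1
  d (suc i) (suc j) = rimDistance (i ≟ᶠ j) (adj? i j)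

  d-self : ∀ u → d u u ≡ 0
  d-self zero = refl
  d-self (suc i) with i ≟ᶠ i
  ... | yes _ = refl
  ... | no i≢i = ⊥-elim (i≢i refl)

  d≡0⇒≡ : ∀ u v → d u v ≡ 0 → u ≡ v
  d≡0⇒≡ zero zero _ = refl
  d≡0⇒≡ (suc i) (suc j) _ with i ≟ᶠ j | adj? i j
  d≡0⇒≡ (suc i) (suc j) _ | yes i≡j | _ = cong suc i≡j
  d≡0⇒≡ (suc i) (suc j) () | no _ | yes _
  d≡0⇒≡ (suc i) (suc j) () | no _ | no _

  d-adj : ∀ {i j} → i ≢ j → Adj i j → d (suc i) (suc j) ≡ 1
  d-adj {i} {j} i≢j a with i ≟ᶠ j | adj? i j
  ... | yes i≡j | _ = ⊥-elim (i≢j i≡j)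
  ... | no _ | yes _ = refl
  ... | no _ | no ¬a = ⊥-elim (¬a a)

  d-far : ∀ {i j} → i ≢ j → ¬ Adj i j → d (suc i) (suc j) ≡ 2
  d-far {i} {j} i≢j ¬a with i ≟ᶠ j | adj? i j
  ... | yes i≡j | _ = ⊥-elim (i≢j i≡j)
  ... | no _ | yes a = ⊥-elim (¬a a)
  ... | no _ | no _ = refl

  private
    walk₀ : ∀ {u v} → Walk (Wheel n) u v 0 → u ≡ v
    walk₀ here = refl

    walk₁ : ∀ {u v} → Walk (Wheel n) u v 1 → WheelAdj n u v
    walk₁ (step a here) = a

  dist : ∀ u v → Dist (Wheel n) u v (d u v)
  dist zero zero = here , λ _ _ → z≤n
  dist zero (suc j) = step (hub-rim j) here , λ where
    zero w → case walk₀ w of λ ()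
    (suc l) _ → s≤s z≤n
  dist (suc i) zero = step (rim-hub i) here , λ where
    zero w → case walk₀ w of λ ()
    (suc l) _ → s≤s z≤n
  dist (suc i) (suc j) with i ≟ᶠ j | adj? i j
  ... | yes refl | _ = here , λ _ _ → z≤n
  ... | no i≢j | yes a = step (adj⇒wheelAdj a) here , λ where
    zero w → ⊥-elim (i≢j (suc-injective (walk₀ w)))
    (suc l) _ → s≤s z≤n
  ... | no i≢j | no ¬a = step (rim-hub i) (step (hub-rim j) here) , λ where
    zero w → ⊥-elim (i≢j (suc-injective (walk₀ w)))
    (suc zero) w → ⊥-elim (¬a (wheelAdj⇒adj (walk₁ w)))
    (suc (suc l)) _ → s≤s (s≤s z≤n)

  dist-unique : ∀ {u v k} → Dist (Wheel n) u v k → k ≡ d u v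
  dist-unique {u} {v} (w , shortest) = ≤-antisym (shortest _ (proj₁ (dist u v))) (proj₂ (dist u v) _ w)

  Separates : Subset (suc n) → Fin (suc n) → Fin (suc n) → Set
  Separates W u v = Σ (Fin (suc n)) λ w → w ∈ W × d w u ≢ d w v

  resolving⁺ : ∀ {W} → (∀ u v → u ≢ v → Separates W u v) → Resolving (Wheel n) W
  resolving⁺ separate u v u≢v with separate u v u≢v
  ... | w , w∈W , du≢dv = w , w∈W , d w u , d w v , dist w u , dist w v , du≢dv

  resolving⁻ : ∀ {W} → Resolving (Wheel n) W → ∀ u v → u ≢ v → Separates W u v
  resolving⁻ res u v u≢v with res u v u≢v
  ... | w , w∈W , k , l , dk , dl , k≢l =
    w , w∈W , λ du≡dv → k≢l (trans (dist-unique dk) (trans du≡dv (sym (dist-unique dl))))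

  resolving? : ∀ W → Dec (Resolving (Wheel n) W)
  resolving? W = map′ resolving⁺ resolving⁻
    (all? λ u → all? λ v → ¬? (u ≟ᶠ v) →-dec any? λ w → (w ∈? W) ×-dec ¬? (d w u ≟ d w v))

ExchangeCounterexample : (n : ℕ) → (S R : Subset (suc n)) → Fin (suc n) → Set
ExchangeCounterexample n S R r =
  MinimalResolving (Wheel n) S × MinimalResolving (Wheel n) R × r ∈ R ×
  ((s : Fin (suc n)) → s ∈ S → ¬ MinimalResolving (Wheel n) ((S - s) ∪ ⁅ r ⁆))

exchangeCounterexample? : ∀ n S R r → Dec (ExchangeCounterexample n S R r)
exchangeCounterexample? n S R r =
  minimal? S ×-dec minimal? R ×-dec r ∈? R ×-dec
  (all? λ s → s ∈? S →-dec ¬? (minimal? ((S - s) ∪ ⁅ r ⁆)))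
  where minimal? = minimalResolving? (Distance.resolving? n)

Counterexample : ℕ → Set
Counterexample n = Σ (Subset (suc n)) λ S → Σ (Subset (suc n)) λ R → Σ (Fin (suc n)) λ r →
  ExchangeCounterexample n S R r

-- Sets of rim vertices

rimSet : ∀ {n} → (Fin n → Bool) → Subset (suc n)
rimSet t = outside ∷ tabulate t

module RimSets (n : ℕ) where
  open Rim n
  open Distance n

  ∈rimSet⁺ : ∀ {t : Fin n → Bool} {i} → t i ≡ true → suc i ∈ rimSet t
  ∈rimSet⁺ {t} {i} ti = there (lookup⇒[]= i (tabulate t) (trans (lookup∘tabulate t i) ti))

  ∈rimSet⁻ : ∀ {t : Fin n → Bool} {i} → suc i ∈ rimSet t → t i ≡ true
  ∈rimSet⁻ {t} {i} (there i∈) = trans (sym (lookup∘tabulate t i)) ([]=⇒lookup i∈)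

  hub∉rimSet : ∀ {t : Fin n → Bool} → zero ∉ rimSet t
  hub∉rimSet ()

  member≢nonmember : ∀ (t : Fin n → Bool) {i j} → t i ≡ true → t j ≡ false → i ≢ j
  member≢nonmember t ti tj refl with trans (sym ti) tj
  ... | ()

  IsHole : (Fin n → Bool) → Fin n → Set
  IsHole t v = t (pv v) ≡ false × t v ≡ false × t (nx v) ≡ false

  d-member-hole : ∀ {t v w} → IsHole t v → t w ≡ true → d (suc w) (suc v) ≡ 2
  d-member-hole {t} {v} {w} (tpv , tv , tnx) tw = d-far (member≢nonmember t tw tv) λ where
    (inj₁ v≡nx) → member≢nonmember t tw tpv (trans (sym (pv-nx w)) (cong pv (sym v≡nx)))
    (inj₂ v≡pv) → member≢nonmember t tw tnx (trans (sym (nx-pv w)) (cong nx (sym v≡pv)))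

  two-holes⇒¬resolving : ∀ {t u v} → IsHole t u → IsHole t v → u ≢ v → ¬ Resolving (Wheel n) (rimSet t)
  two-holes⇒¬resolving hu hv u≢v res with resolving⁻ res _ _ (u≢v ∘ suc-injective)
  ... | zero , hub∈ , _ = hub∉rimSet hub∈
  ... | suc w , w∈ , ne = ne (trans (d-member-hole hu (∈rimSet⁻ w∈)) (sym (d-member-hole hv (∈rimSet⁻ w∈))))

  three-members⇒hub-separated : ∀ {t : Fin n → Bool} {a b c} →
    t a ≡ true → t b ≡ true → t c ≡ true → a ≢ b → a ≢ c → b ≢ c →
    ∀ v → t v ≡ false → Σ (Fin n) λ w → t w ≡ true × ¬ Adj w v
  three-members⇒hub-separated {a = a} {b} {c} ta tb tc a≢b a≢c b≢c v _
    with adj? a v | adj? b v | adj? c v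
  ... | no ¬av | _ | _ = a , ta , ¬av
  ... | yes _ | no ¬bv | _ = b , tb , ¬bv
  ... | yes _ | yes _ | no ¬cv = c , tc , ¬cv
  ... | yes av | yes bv | yes cv = ⊥-elim (pigeonhole (side av) (side bv) (side cv))
    where
    side : ∀ {x} → Adj x v → x ≡ pv v ⊎ x ≡ nx v
    side {x} (inj₁ v≡nx) = inj₁ (trans (sym (pv-nx x)) (cong pv (sym v≡nx)))
    side {x} (inj₂ v≡pv) = inj₂ (trans (sym (nx-pv x)) (cong nx (sym v≡pv)))

    pigeonhole : a ≡ pv v ⊎ a ≡ nx v → b ≡ pv v ⊎ b ≡ nx v → c ≡ pv v ⊎ c ≡ nx v → ⊥
    pigeonhole (inj₁ p) (inj₁ q) _ = a≢b (trans p (sym q))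
    pigeonhole (inj₂ p) (inj₂ q) _ = a≢b (trans p (sym q))
    pigeonhole (inj₁ p) _ (inj₁ q) = a≢c (trans p (sym q))
    pigeonhole (inj₂ p) _ (inj₂ q) = a≢c (trans p (sym q))
    pigeonhole _ (inj₁ p) (inj₁ q) = b≢c (trans p (sym q))
    pigeonhole _ (inj₂ p) (inj₂ q) = b≢c (trans p (sym q))

  erase : (Fin n → Bool) → Fin n → Fin n → Bool
  erase t y = updateAt t y λ _ → false

  insert : (Fin n → Bool) → Fin n → Fin n → Bool
  insert t r = updateAt t r λ _ → true

  erase-false : ∀ {t : Fin n → Bool} {i} y → t i ≡ false → erase t y i ≡ false
  erase-false {t} {i} y ti with i ≟ᶠ y
  ... | yes refl = updateAt-updates i t
  ... | no i≢y = trans (updateAt-minimal i y t i≢y) ti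

  insert-false : ∀ {t : Fin n → Bool} {i} r → i ≢ r → t i ≡ false → insert t r i ≡ false
  insert-false {t} {i} r i≢r ti = trans (updateAt-minimal i r t i≢r) ti

  erase-⊆ : ∀ {t} y → rimSet t - suc y ⊆ rimSet (erase t y)
  erase-⊆ {t} y {zero} x∈ = ⊥-elim (hub∉rimSet {t} (proj₁ (x∈p-y⁻ {y = suc y} {p = rimSet t} x∈)))
  erase-⊆ {t} y {suc x} x∈ with x∈p-y⁻ x∈
  ... | x∈S , x≢y = ∈rimSet⁺ {erase t y} (trans (updateAt-minimal x y t (x≢y ∘ cong suc)) (∈rimSet⁻ x∈S))

  exchange-⊆ : ∀ {t} y r → (rimSet t - suc y) ∪ ⁅ suc r ⁆ ⊆ rimSet (insert (erase t y) r)
  exchange-⊆ {t} y r {x} x∈ with x∈p∪q⁻ (rimSet t - suc y) _ x∈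
  ... | inj₂ x∈⁅r⁆ rewrite x∈⁅y⁆⇒x≡y (suc r) x∈⁅r⁆ = ∈rimSet⁺ (updateAt-updates r (erase t y))
  ... | inj₁ x∈S-y with x | erase-⊆ y x∈S-y
  ...   | zero | hub∈ = ⊥-elim (hub∉rimSet hub∈)
  ...   | suc x′ | x′∈ with x′ ≟ᶠ r
  ...     | yes refl = ∈rimSet⁺ (updateAt-updates r (erase t y))
  ...     | no x′≢r = ∈rimSet⁺ (trans (updateAt-minimal x′ r _ x′≢r) (∈rimSet⁻ x′∈))

  record OneHoleIndependent (t : Fin n → Bool) : Set where
    field
      independent : ∀ i → t i ≡ true → t (nx i) ≡ false
      spread : ∀ i → t i ≡ true → t (pv (pv i)) ≡ true ⊎ t (nx (nx i)) ≡ true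
      hole : Fin n
      isHole : IsHole t hole
      hole-unique : ∀ v → IsHole t v → v ≡ hole
      hub-separated : ∀ v → t v ≡ false → Σ (Fin n) λ w → t w ≡ true × ¬ Adj w v

    independent-pv : ∀ i → t i ≡ true → t (pv i) ≡ false
    independent-pv i ti with t (pv i) in tpv
    ... | false = refl
    ... | true = ⊥-elim (member≢nonmember t ti (trans (cong t (sym (nx-pv i))) (independent (pv i) tpv)) refl)

    hole-false : t hole ≡ false
    hole-false = proj₁ (proj₂ isHole)

    erased-hole : ∀ y → t y ≡ true → IsHole (erase t y) y
    erased-hole y ty = erase-false y (independent-pv y ty) , updateAt-updates y t , erase-false y (independent y ty)

  rotate : ∀ {t} → OneHoleIndependent t → OneHoleIndependent (t ∘ pv)
  rotate {t} P = record
    { independent = λ i ti → trans (cong t (pv-nx i)) (trans (cong t (sym (nx-pv i))) (independent (pv i) ti))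
    ; spread = λ i ti →
        map₂ (λ e → trans (cong t (pv-nx (nx i))) (trans (cong (t ∘ nx) (sym (nx-pv i))) e)) (spread (pv i) ti)
    ; hole = nx hole
    ; isHole = let (tpv , th , tnx) = isHole in
        trans (cong (t ∘ pv) (pv-nx hole)) tpv , trans (cong t (pv-nx hole)) th , trans (cong t (pv-nx (nx hole))) tnx
    ; hole-unique = λ v (tpv , tv , tnx) → trans (sym (nx-pv v)) (cong nx
        (hole-unique (pv v) (tpv , tv , trans (cong t (nx-pv v)) (trans (cong t (sym (pv-nx v))) tnx))))
    ; hub-separated = λ v tv → let (w , tw , ¬adj) = hub-separated (pv v) tv in
        nx w , trans (cong t (pv-nx w)) tw , λ where
          (inj₁ v≡nx²w) → ¬adj (inj₁ (trans (cong pv v≡nx²w) (pv-nx (nx w))))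
          (inj₂ v≡w) → ¬adj (inj₂ (cong pv (trans v≡w (pv-nx w))))
    }
    where open OneHoleIndependent P

  module _ (5≤n : 5 ≤ n) where

    private
      1≢2 : 1 ≢ 2
      1≢2 ()

      nx^≢ : ∀ (k : Fin 4) x → iterate nx x (suc (toℕ k)) ≢ x
      nx^≢ k x = nx^-irrefl (suc (toℕ k)) x (s≤s z≤n) (<-≤-trans (s≤s (toℕ<n k)) 5≤n)

      pv≢nx : ∀ x → pv x ≢ nx x
      pv≢nx x e = nx^≢ (# 1) x (sym (trans (sym (nx-pv x)) (cong nx e)))

    pv²-far-from-nx : ∀ x → ¬ Adj (pv (pv x)) (nx x)
    pv²-far-from-nx x (inj₁ e) = pv≢nx x (sym (trans e (nx-pv (pv x))))
    pv²-far-from-nx x (inj₂ e) = nx^≢ (# 3) x (begin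
      nx (nx (nx (nx x)))              ≡⟨ cong (nx ∘ nx ∘ nx) e ⟩
      nx (nx (nx (pv (pv (pv x)))))    ≡⟨ cong (nx ∘ nx) (nx-pv (pv (pv x))) ⟩
      nx (nx (pv (pv x)))              ≡⟨ cong nx (nx-pv (pv x)) ⟩
      nx (pv x)                        ≡⟨ nx-pv x ⟩
      x                                ∎)
      where open ≡-Reasoning

    nx²-far-from-pv : ∀ x → ¬ Adj (nx (nx x)) (pv x)
    nx²-far-from-pv x (inj₁ e) = nx^≢ (# 3) x (sym (trans (sym (nx-pv x)) (cong nx e)))
    nx²-far-from-pv x (inj₂ e) = pv≢nx x (trans e (pv-nx (nx x)))

    rimSet-resolving : ∀ t →
      (∀ i → t i ≡ true → t (pv i) ≡ false → t (nx i) ≡ false →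
        t (pv (pv i)) ≡ true ⊎ t (nx (nx i)) ≡ true) →
      (∀ u v → IsHole t u → IsHole t v → u ≡ v) →
      (∀ v → t v ≡ false → Σ (Fin n) λ w → t w ≡ true × ¬ Adj w v) →
      Resolving (Wheel n) (rimSet t)
    rimSet-resolving t spread holes-equal hub-separated = resolving⁺ separate
      where
      W = rimSet t

      flip : ∀ {u v} → Separates W u v → Separates W v u
      flip (w , w∈W , ne) = w , w∈W , ne ∘ sym

      by-member : ∀ {i} v → t i ≡ true → suc i ≢ v → Separates W (suc i) v
      by-member {i} v ti i≢v =
        suc i , ∈rimSet⁺ ti , λ e → i≢v (d≡0⇒≡ (suc i) v (trans (sym e) (d-self (suc i))))

      by-neighbour : ∀ {w a b} → t w ≡ true → t a ≡ false → t b ≡ false → Adj w a → ¬ Adj w b →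
                     Separates W (suc a) (suc b)
      by-neighbour {w} tw ta tb wa ¬wb = suc w , ∈rimSet⁺ tw , λ e → 1≢2 (begin
        1                   ≡⟨ sym (d-adj (member≢nonmember t tw ta) wa) ⟩
        d (suc w) (suc _)   ≡⟨ e ⟩
        d (suc w) (suc _)   ≡⟨ d-far (member≢nonmember t tw tb) ¬wb ⟩
        2                   ∎)
        where open ≡-Reasoning

      common-neighbour : ∀ {w} → t w ≡ true → t (pv w) ≡ false → t (nx w) ≡ false →
                         Separates W (suc (nx w)) (suc (pv w))
      common-neighbour {w} tw tpv tnx with spread w tw tpv tnx
      ... | inj₁ tpv² = flip (by-neighbour tpv² tpv tnx (inj₁ (sym (nx-pv (pv w)))) (pv²-far-from-nx w))
      ... | inj₂ tnx² = by-neighbour tnx² tnx tpv (inj₂ (sym (pv-nx (nx w)))) (nx²-far-from-pv w)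

      by-some-neighbour : ∀ {w a b} → a ≢ b → t a ≡ false → t b ≡ false → t w ≡ true → Adj w a →
                          Separates W (suc a) (suc b)
      by-some-neighbour {w} {a} {b} a≢b ta tb tw wa with adj? w b
      ... | no ¬wb = by-neighbour tw ta tb wa ¬wb
      by-some-neighbour a≢b ta tb tw (inj₁ refl) | yes (inj₂ refl) = common-neighbour tw tb ta
      by-some-neighbour a≢b ta tb tw (inj₂ refl) | yes (inj₁ refl) = flip (common-neighbour tw ta tb)
      by-some-neighbour a≢b ta tb tw (inj₁ refl) | yes (inj₁ refl) = ⊥-elim (a≢b refl)
      by-some-neighbour a≢b ta tb tw (inj₂ refl) | yes (inj₂ refl) = ⊥-elim (a≢b refl)

      neighbour-or-hole : ∀ a → t a ≡ false → (Σ (Fin n) λ w → t w ≡ true × Adj w a) ⊎ IsHole t a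
      neighbour-or-hole a ta with t (nx a) in tnx | t (pv a) in tpv
      ... | true | _ = inj₁ (nx a , tnx , inj₂ (sym (pv-nx a)))
      ... | false | true = inj₁ (pv a , tpv , inj₁ (sym (nx-pv a)))
      ... | false | false = inj₂ (refl , ta , refl)

      nonmembers : ∀ {a b} → a ≢ b → t a ≡ false → t b ≡ false → Separates W (suc a) (suc b)
      nonmembers {a} {b} a≢b ta tb with neighbour-or-hole a ta | neighbour-or-hole b tb
      ... | inj₁ (w , tw , wa) | _ = by-some-neighbour a≢b ta tb tw wa
      ... | inj₂ _ | inj₁ (w , tw , wb) = flip (by-some-neighbour (a≢b ∘ sym) tb ta tw wb)
      ... | inj₂ hole-a | inj₂ hole-b = ⊥-elim (a≢b (holes-equal a b hole-a hole-b))

      hub-vs-rim : ∀ j → t j ≡ false → Separates W zero (suc j)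
      hub-vs-rim j tj with hub-separated j tj
      ... | w , tw , ¬wj = suc w , ∈rimSet⁺ tw , λ e → 1≢2 (trans e (d-far (member≢nonmember t tw tj) ¬wj))

      separate : ∀ u v → u ≢ v → Separates W u v
      separate zero zero u≢v = ⊥-elim (u≢v refl)
      separate zero (suc j) u≢v with t j in tj
      ... | true = flip (by-member zero tj (u≢v ∘ sym))
      ... | false = hub-vs-rim j tj
      separate (suc i) zero u≢v with t i in ti
      ... | true = by-member zero ti u≢v
      ... | false = flip (hub-vs-rim i ti)
      separate (suc i) (suc j) u≢v with t i in ti | t j in tj
      ... | true | _ = by-member (suc j) ti u≢v
      ... | false | true = flip (by-member (suc i) tj (u≢v ∘ sym))
      ... | false | false = nonmembers (u≢v ∘ cong suc) ti tj

    module _ {t : Fin n → Bool} (P : OneHoleIndependent t) where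
      open OneHoleIndependent P

      oneHole-resolving : Resolving (Wheel n) (rimSet t)
      oneHole-resolving = rimSet-resolving t (λ i ti _ _ → spread i ti)
        (λ u v hu hv → trans (hole-unique u hu) (sym (hole-unique v hv))) hub-separated

      oneHole-minimal : MinimalResolving (Wheel n) (rimSet t)
      oneHole-minimal = minimalResolving⁺ oneHole-resolving λ where
        zero hub∈ _ → hub∉rimSet {t} hub∈
        (suc y) y∈ res → let ty = ∈rimSet⁻ y∈ in
          two-holes⇒¬resolving (erased-hole y ty)
            (let (tpv , th , tnx) = isHole in erase-false y tpv , erase-false y th , erase-false y tnx)
            (member≢nonmember t ty hole-false) (resolving-⊆ (erase-⊆ y) res)

      module _ (b : Fin n) (tb : t b ≡ false) (tb₂ : t (iterate nx b 2) ≡ true)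
               (tb₄ : t (iterate nx b 4) ≡ true) (tb₆ : t (iterate nx b 6) ≡ false) where

        private
          r = iterate nx b 3

          exchanged : Fin n → Fin n → Bool
          exchanged y = insert (erase t y) r

          pv-r : pv r ≡ iterate nx b 2
          pv-r = pv-nx (iterate nx b 2)

          tr : t r ≡ false
          tr = independent _ tb₂

          hole-before-r : IsHole (exchanged (iterate nx b 2)) (nx b)
          hole-before-r =
            trans (cong (exchanged _) (pv-nx b)) (insert-false r (nx^≢ (# 2) b ∘ sym) (erase-false _ tb)) ,
            insert-false r (nx^≢ (# 1) (nx b) ∘ sym)
              (erase-false _ (trans (cong t (sym (pv-nx (nx b)))) (independent-pv _ tb₂))) ,
            insert-false r (nx^≢ (# 0) (iterate nx b 2) ∘ sym) (updateAt-updates _ t)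

          hole-after-r : IsHole (exchanged (iterate nx b 4)) (iterate nx b 5)
          hole-after-r =
            trans (cong (exchanged _) (pv-nx (iterate nx b 4))) (insert-false r (nx^≢ (# 0) r) (updateAt-updates _ t)) ,
            insert-false r (nx^≢ (# 1) r) (erase-false _ (independent _ tb₄)) ,
            insert-false r (nx^≢ (# 2) r) (erase-false _ tb₆)

          hole-at-removed : ∀ y → t y ≡ true → y ≢ iterate nx b 2 → y ≢ iterate nx b 4 → IsHole (exchanged y) y
          hole-at-removed y ty y≢b₂ y≢b₄ = let (tpv , ty′ , tnx) = erased-hole y ty in
            insert-false r (λ pv-y≡r → y≢b₄ (trans (sym (nx-pv y)) (cong nx pv-y≡r))) tpv ,
            insert-false r (member≢nonmember t ty tr) ty′ ,
            insert-false r (λ nx-y≡r → y≢b₂ (trans (sym (pv-nx y)) (trans (cong pv nx-y≡r) pv-r))) tnx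

          new-hole : ∀ y → t y ≡ true → Σ (Fin n) λ v → IsHole (exchanged y) v × v ≢ hole
          new-hole y ty with y ≟ᶠ iterate nx b 2 | y ≟ᶠ iterate nx b 4
          ... | yes refl | _ = nx b , hole-before-r ,
            λ nxb≡hole → member≢nonmember t tb₂ (proj₂ (proj₂ isHole)) (cong nx nxb≡hole)
          ... | no _ | yes refl = iterate nx b 5 , hole-after-r ,
            λ b₅≡hole → member≢nonmember t tb₄ (proj₁ isHole) (trans (sym (pv-nx y)) (cong pv b₅≡hole))
          ... | no y≢b₂ | no y≢b₄ = y , hole-at-removed y ty y≢b₂ y≢b₄ , member≢nonmember t ty hole-false

          old-hole : ∀ y → IsHole (exchanged y) hole
          old-hole y = let (tpv , th , tnx) = isHole in
            insert-false r (λ e → member≢nonmember t tb₄ th (trans (cong nx (sym e)) (nx-pv hole))) (erase-false y tpv) ,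
            insert-false r (λ e → member≢nonmember t tb₄ tnx (cong nx (sym e))) (erase-false y th) ,
            insert-false r (λ e → member≢nonmember t tb₂ th (trans (sym pv-r) (trans (cong pv (sym e)) (pv-nx hole))))
              (erase-false y tnx)

        oneHole-exchange-¬resolving : ∀ s → s ∈ rimSet t → ¬ Resolving (Wheel n) ((rimSet t - s) ∪ ⁅ suc r ⁆)
        oneHole-exchange-¬resolving zero hub∈ _ = hub∉rimSet {t} hub∈
        oneHole-exchange-¬resolving (suc y) y∈ res with new-hole y (∈rimSet⁻ y∈)
        ... | v , hole-v , v≢hole =
          two-holes⇒¬resolving hole-v (old-hole y) v≢hole (resolving-⊆ (exchange-⊆ y r) res)

    oneHole-counterexample : ∀ {t} (P : OneHoleIndependent t) b →
      t b ≡ false → t (iterate nx b 2) ≡ true → t (iterate nx b 4) ≡ true → t (iterate nx b 6) ≡ false →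
      ExchangeCounterexample n (rimSet t) (rimSet (t ∘ pv)) (suc (iterate nx b 3))
    oneHole-counterexample {t} P b tb tb₂ tb₄ tb₆ =
      oneHole-minimal P , oneHole-minimal (rotate P) ,
      ∈rimSet⁺ (trans (cong t (pv-nx (iterate nx b 2))) tb₂) ,
      λ s s∈S min → oneHole-exchange-¬resolving P b tb tb₂ tb₄ tb₆ s s∈S (proj₁ min)

-- Eventually alternating words

alternating : ℕ → Bool
alternating zero = true
alternating (suc zero) = false
alternating (suc (suc k)) = alternating k

alternating-suc : ∀ k → alternating (suc k) ≡ not (alternating k)
alternating-suc zero = refl
alternating-suc (suc zero) = refl
alternating-suc (suc (suc k)) = alternating-suc k

alternating-even : ∀ j l → alternating (2 * j + l) ≡ alternating l
alternating-even zero l = refl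
alternating-even (suc j) l = trans (cong (λ m → alternating (m + l)) (*-suc 2 j)) (alternating-even j l)

word : List Bool → ℕ → Bool
word [] k = alternating k
word (x ∷ xs) zero = x
word (x ∷ xs) (suc k) = word xs k

word-beyond : ∀ xs k → word xs (length xs + k) ≡ alternating k
word-beyond [] k = refl
word-beyond (x ∷ xs) k = word-beyond xs k

word-suc : ∀ xs {k} → length xs ≤ k → word xs (suc k) ≡ not (word xs k)
word-suc [] {k} _ = alternating-suc k
word-suc (x ∷ xs) (s≤s len≤k) = word-suc xs len≤k

word-period : ∀ xs {k} → length xs ≤ k → word xs (2 + k) ≡ word xs k
word-period [] _ = refl
word-period (x ∷ xs) {suc k} (s≤s len≤k) = word-period xs len≤k

record WordFacts (P : ℕ → Bool) : Set where
  field
    independentℕ : ∀ k → P k ≡ true → P (suc k) ≡ false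
    spreadℕ : ∀ k → P (2 + k) ≡ true → P k ≡ true ⊎ P (4 + k) ≡ true
    holeℕ : ∀ k → P k ≡ false → P (1 + k) ≡ false → P (2 + k) ≡ false → k ≡ 3

module _ (xs : List Bool) where

  private
    P = word xs

    IndependentAt SpreadAt HoleAt : ℕ → Set
    IndependentAt k = P k ≡ true → P (suc k) ≡ false
    SpreadAt k = P (2 + k) ≡ true → P k ≡ true ⊎ P (4 + k) ≡ true
    HoleAt k = P k ≡ false → P (1 + k) ≡ false → P (2 + k) ≡ false → k ≡ 3

  -- The second component says the word starts like its alternating tail, so that its prefix of
  -- length (length xs + 2 j), read cyclically, looks locally like the infinite word.
  PrefixChecks : Set
  PrefixChecks = (∀ (k : Fin (length xs)) → IndependentAt (toℕ k) × SpreadAt (toℕ k) × HoleAt (toℕ k))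
               × (∀ (l : Fin 4) → P (toℕ l) ≡ alternating (toℕ l))

  prefixChecks? : Dec PrefixChecks
  prefixChecks? =
    all? (λ k → let k = toℕ k in
      (P k ≟ᵇ true →-dec P (suc k) ≟ᵇ false) ×-dec
      (P (2 + k) ≟ᵇ true →-dec (P k ≟ᵇ true ⊎-dec P (4 + k) ≟ᵇ true)) ×-dec
      (P k ≟ᵇ false →-dec P (1 + k) ≟ᵇ false →-dec P (2 + k) ≟ᵇ false →-dec k ≟ 3))
    ×-dec all? (λ l → P (toℕ l) ≟ᵇ alternating (toℕ l))

  private
    below-or-beyond : ∀ {Φ : ℕ → Set} → (∀ (i : Fin (length xs)) → Φ (toℕ i)) →
                      (∀ k → length xs ≤ k → Φ k) → ∀ k → Φ k
    below-or-beyond {Φ} below beyond k with k <? length xs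
    ... | yes k<len = subst Φ (toℕ-fromℕ< k<len) (below (fromℕ< k<len))
    ... | no k≮len = beyond k (≮⇒≥ k≮len)

    true≢false : true ≢ false
    true≢false ()

  wordFacts : PrefixChecks → WordFacts P
  wordFacts (checks , _) = record
    { independentℕ = below-or-beyond (λ i → let (c , _ , _) = checks i in c) λ k len≤k Pk →
        trans (word-suc xs len≤k) (cong not Pk)
    ; spreadℕ = below-or-beyond (λ i → let (_ , c , _) = checks i in c) λ k len≤k P2k →
        inj₁ (trans (sym (word-period xs len≤k)) P2k)
    ; holeℕ = below-or-beyond (λ i → let (_ , _ , c) = checks i in c) λ k len≤k Pk P1k _ →
        ⊥-elim (true≢false (trans (sym (trans (word-suc xs len≤k) (cong not Pk))) P1k))
    }

  word-wrap : PrefixChecks → ∀ j l → l < 4 → P (length xs + 2 * j + l) ≡ P l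
  word-wrap (_ , start) j l l<4 = begin
    P (length xs + 2 * j + l)    ≡⟨ cong P (+-assoc (length xs) (2 * j) l) ⟩
    P (length xs + (2 * j + l))  ≡⟨ word-beyond xs (2 * j + l) ⟩
    alternating (2 * j + l)      ≡⟨ alternating-even j l ⟩
    alternating l                ≡⟨ sym (subst (λ m → P m ≡ alternating m) (toℕ-fromℕ< l<4) (start (fromℕ< l<4))) ⟩
    P l                          ∎
    where open ≡-Reasoning

-- The two families of wheels

prefix : List Bool → List Bool
prefix ys = true ∷ false ∷ true ∷ false ∷ false ∷ false ∷ true ∷ false ∷ true ∷ false ∷ false ∷ ys

module Family (ys : List Bool) (checks : PrefixChecks (prefix ys)) (j : ℕ) where

  P = word (prefix ys)
  n = length (prefix ys) + 2 * j

  open Rim n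
  open RimSets n
  open WordFacts (wordFacts (prefix ys) checks)

  private
    11≤n : 11 ≤ n
    11≤n = m≤m+n 11 (length ys + 2 * j)

    5≤n : 5 ≤ n
    5≤n = ≤-trans (m≤m+n 5 6) 11≤n

  t : Fin n → Bool
  t i = P (toℕ i)

  t-nx^ : ∀ (k : Fin 5) x → t (iterate nx x (toℕ k)) ≡ P (toℕ k + toℕ x)
  t-nx^ k x with nx^-position (toℕ k) x (<-≤-trans (toℕ<n k) 5≤n)
  ... | inj₁ p = cong P (trans p (+-comm (toℕ x) (toℕ k)))
  ... | inj₂ p = begin
    P (toℕ y)              ≡⟨ sym (word-wrap (prefix ys) checks j (toℕ y) y<4) ⟩
    P (n + toℕ y)          ≡⟨ cong P (trans (+-comm n (toℕ y)) (trans p (+-comm (toℕ x) (toℕ k)))) ⟩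
    P (toℕ k + toℕ x)      ∎
    where
    open ≡-Reasoning
    y = iterate nx x (toℕ k)
    y<4 : toℕ y < 4
    y<4 = <-≤-trans (+-cancelʳ-< n (toℕ y) (toℕ k) (subst (_< toℕ k + n) (sym (trans p (+-comm (toℕ x) (toℕ k))))
                                                         (+-monoʳ-< (toℕ k) (toℕ<n x))))
                    (≤-pred (toℕ<n k))

  at : ℕ → Fin n
  at k = iterate nx zero k

  toℕ-at : ∀ (k : Fin 11) → toℕ (at (toℕ k)) ≡ toℕ k
  toℕ-at k = nx^-inner (toℕ k) zero (<-≤-trans (toℕ<n k) 11≤n)

  t-at : ∀ (k : Fin 11) → t (at (toℕ k)) ≡ P (toℕ k)
  t-at k = cong P (toℕ-at k)

  at-injective : ∀ (k l : Fin 11) → at (toℕ k) ≡ at (toℕ l) → toℕ k ≡ toℕ l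
  at-injective k l e = trans (sym (toℕ-at k)) (trans (cong toℕ e) (toℕ-at l))

  oneHole : OneHoleIndependent t
  oneHole = record
    { independent = λ i ti → trans (t-nx^ (# 1) i) (independentℕ (toℕ i) ti)
    ; spread = λ i → spread-from (pv (pv i)) (trans (cong nx (nx-pv (pv i))) (nx-pv i))
    ; hole = at 4
    ; isHole = trans (cong t (pv-nx (at 3))) (t-at (# 3)) , t-at (# 4) , t-at (# 5)
    ; hole-unique = hole-unique
    ; hub-separated = three-members⇒hub-separated (t-at (# 0)) (t-at (# 2)) (t-at (# 6))
        (λ e → case at-injective (# 0) (# 2) e of λ ())
        (λ e → case at-injective (# 0) (# 6) e of λ ())
        (λ e → case at-injective (# 2) (# 6) e of λ ())
    }
    where
    spread-from : ∀ x {i} → iterate nx x 2 ≡ i → t i ≡ true → t x ≡ true ⊎ t (nx (nx i)) ≡ true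
    spread-from x refl ti with spreadℕ (toℕ x) (trans (sym (t-nx^ (# 2) x)) ti)
    ... | inj₁ Px = inj₁ Px
    ... | inj₂ Px+4 = inj₂ (trans (t-nx^ (# 4) x) Px+4)

    hole-unique : ∀ v → IsHole t v → v ≡ at 4
    hole-unique v (tpv , tv , tnx) = toℕ-injective (begin
      toℕ v                ≡⟨ cong toℕ (sym (nx-pv v)) ⟩
      toℕ (nx (pv v))      ≡⟨ nx^-inner 1 (pv v) (subst (λ m → m + 1 < n) (sym pv≡3) (<-≤-trans (toℕ<n (# 4)) 11≤n)) ⟩
      toℕ (pv v) + 1       ≡⟨ cong (_+ 1) pv≡3 ⟩
      4                    ≡⟨ sym (toℕ-at (# 4)) ⟩
      toℕ (at 4)           ∎)
      where
      open ≡-Reasoning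
      pv≡3 : toℕ (pv v) ≡ 3
      pv≡3 = holeℕ (toℕ (pv v)) tpv
        (trans (sym (t-nx^ (# 1) (pv v))) (trans (cong t (nx-pv v)) tv))
        (trans (sym (t-nx^ (# 2) (pv v))) (trans (cong (t ∘ nx) (nx-pv v)) tnx))

  counterexample : ExchangeCounterexample n (rimSet t) (rimSet (t ∘ pv)) (suc (iterate nx (at 4) 3))
  counterexample = oneHole-counterexample 5≤n oneHole (at 4) (t-at (# 4)) (t-at (# 6)) (t-at (# 8)) (t-at (# 10))

familyCounterexample : ∀ ys → PrefixChecks (prefix ys) → ∀ j → Counterexample (length (prefix ys) + 2 * j)
familyCounterexample ys checks j = _ , _ , _ , counterexample
  where open Family ys checks j

oddWheel : ∀ j → Counterexample (11 + 2 * j)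
oddWheel = familyCounterexample [] (toWitness {a? = prefixChecks? (prefix [])} _)

evenWheel : ∀ j → Counterexample (16 + 2 * j)
evenWheel = familyCounterexample ys (toWitness {a? = prefixChecks? (prefix ys)} _)
  where ys = true ∷ false ∷ true ∷ false ∷ false ∷ []

-- The small wheels

rimPositions : ∀ {n} → List ℕ → Subset (suc n)
rimPositions ps = rimSet λ i → any (toℕ i ≡ᵇ_) ps

decide : ∀ {n} S R r → {True (exchangeCounterexample? n S R r)} → Counterexample n
decide S R r {c} = S , R , r , toWitness c

-- Evaluating the decision procedure needs the rim successor to compute.
opaque
  unfolding Rim.nx Rim.pv

  wheel8 : Counterexample 8
  wheel8 = decide (rimPositions (0 ∷ 2 ∷ 4 ∷ [])) (rimPositions (1 ∷ 3 ∷ 5 ∷ [])) (# 2)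

  wheel9 : Counterexample 9
  wheel9 = decide (rimPositions (0 ∷ 2 ∷ 4 ∷ 6 ∷ [])) (rimPositions (1 ∷ 3 ∷ 5 ∷ 7 ∷ [])) (# 4)

  wheel10 : Counterexample 10
  wheel10 = decide (rimPositions (0 ∷ 2 ∷ 4 ∷ 6 ∷ [])) (rimPositions (1 ∷ 3 ∷ 5 ∷ 7 ∷ [])) (# 4)

  wheel12 : Counterexample 12
  wheel12 = decide (rimPositions (0 ∷ 1 ∷ 3 ∷ 6 ∷ 8 ∷ [])) (rimPositions (2 ∷ 3 ∷ 5 ∷ 8 ∷ 10 ∷ [])) (# 6)

  wheel14 : Counterexample 14
  wheel14 = decide (rimPositions (0 ∷ 1 ∷ 3 ∷ 5 ∷ 8 ∷ 10 ∷ [])) (rimPositions (2 ∷ 3 ∷ 5 ∷ 7 ∷ 10 ∷ 12 ∷ [])) (# 8)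

parity : ∀ m → Σ ℕ λ j → m ≡ 2 * j ⊎ m ≡ 1 + 2 * j
parity 0 = 0 , inj₁ refl
parity 1 = 0 , inj₂ refl
parity (suc (suc m)) with parity m
... | j , inj₁ refl = suc j , inj₁ (sym (*-suc 2 j))
... | j , inj₂ refl = suc j , inj₂ (cong suc (sym (*-suc 2 j)))

theorem15 : (n : ℕ) → 8 ≤ n →
    Σ (Subset (suc n)) λ S → Σ (Subset (suc n)) λ R → Σ (Fin (suc n)) λ r →
      MinimalResolving (Wheel n) S × MinimalResolving (Wheel n) R × r ∈ R ×
      ((s : Fin (suc n)) → s ∈ S → ¬ MinimalResolving (Wheel n) ((S - s) ∪ ⁅ r ⁆))
theorem15 n 8≤n with m≤n⇒∃[o]m+o≡n 8≤n
... | m , refl with parity m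
... | 0 , inj₁ refl = wheel8
... | 1 , inj₁ refl = wheel10
... | 2 , inj₁ refl = wheel12
... | 3 , inj₁ refl = wheel14
... | suc (suc (suc (suc k))) , inj₁ refl =
  subst Counterexample (cong (8 +_) (sym (*-distribˡ-+ 2 4 k))) (evenWheel k)
... | 0 , inj₂ refl = wheel9
... | suc k , inj₂ refl =
  subst Counterexample (cong (9 +_) (sym (*-distribˡ-+ 2 1 k))) (oddWheel k)
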